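{- Let $G$ be a distance-regular graph of diameter $3$ with valency $k$ and intersection number $a_3=k-c_3$ such that $\theta_1=a_3$, where $\theta_1$ is the second largest distinct adjacency eigenvalue (i.e. $G$ is Shilla). If $|\Gamma_3(x)|\le |V(G)|/2$ (where $\Gamma_3(x)$ is the set of vertices at distance $3$ from a vertex $x$), then $h_G\le\lambda_1$, where $\lambda_1=(k-\theta_1)/k$.
   Context: A connected graph of diameter $D$ is distance-regular if there are integers $b_i,c_i$ such that for all vertices $x,y$ at distance $i$, $y$ has exactly $c_i$ neighbours at distance $i-1$ from $x$ and $b_i$ neighbours at distance $i+1$ from $x$; $a_i=k-b_i-c_i$; $|\Gamma_i(x)|$ does not depend on $x$. For $A,B\subseteq V(G)$, $E[A,B]$ is the number of ordered pairs $(x,y)$ with $x\in A$, $y\in B$, $x\sim y$; $\mathrm{vol}(S)=\sum_{x\in S}\deg(x)$; $S^c=V(G)\setminus S$. The Cheeger constant is $h_G=\min\{E[S,S^c]/\mathrm{vol}(S):\emptyset\ne S\subseteq V(G),\ |S|\le|V(G)|/2\}$. $\lambda_1$ is the smallest positive eigenvalue of the normalized Laplacian $I-\frac1kA$. -}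

module Defs where

open import Data.Bool using (Bool; true; false; _∧_; _∨_; not; if_then_else_)
open import Data.Nat using (ℕ; zero; suc; _+_; _*_; _∸_; _≤_; _<_)
open import Data.Fin using (Fin)
open import Data.Fin.Properties using (_≟_)
open import Data.List using (List; allFin; filter; length; map; foldr)
open import Data.Bool.ListAction using (any)
open import Data.Integer using (+_)
open import Data.Product using (Σ; ∃; _×_; _,_)
open import Data.Empty using (⊥)
open import Relation.Nullary using (¬_; does)
open import Relation.Binary.PropositionalEquality using (_≡_; _≢_)
open import Data.Rational as ℚ using (ℚ)

Graph : ℕ → Set
Graph n = Fin n → Fin n → Bool

IsSimple : ∀ {n} → Graph n → Set
IsSimple {n} adj = (∀ (x y : Fin n) → adj x y ≡ adj y x) × (∀ (x : Fin n) → adj x x ≡ false)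

card : ∀ {n} → (Fin n → Bool) → ℕ
card {n} P = length (filter (λ z → P z Data.Bool.≟ true) (allFin n))

-- within i x y : there is a walk of length at most i from x to y  (dist(x,y) ≤ i)
within : ∀ {n} → Graph n → ℕ → Fin n → Fin n → Bool
within adj zero x y = does (x ≟ y)
within {n} adj (suc i) x y = within adj i x y ∨ any (λ z → within adj i x z ∧ adj z y) (allFin n)

atDist : ∀ {n} → Graph n → ℕ → Fin n → Fin n → Bool
atDist adj zero x y = within adj zero x y
atDist adj (suc i) x y = within adj (suc i) x y ∧ not (within adj i x y)

HasDiameter : ∀ {n} → Graph n → ℕ → Set
HasDiameter {n} adj D =
  (∀ (x y : Fin n) → within adj D x y ≡ true) × (Σ (Fin n) λ x → Σ (Fin n) λ y → atDist adj D x y ≡ true)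

record IsDRG {n : ℕ} (adj : Graph n) (D : ℕ) : Set where
  field
    simple   : IsSimple adj
    diameter : HasDiameter adj D
    k        : ℕ
    b        : ℕ → ℕ
    c        : ℕ → ℕ
    regular  : ∀ (x : Fin n) → card (adj x) ≡ k
    c-prop   : ∀ (i : ℕ) (x y : Fin n) → 1 ≤ i → i ≤ D → atDist adj i x y ≡ true →
               card (λ z → adj y z ∧ atDist adj (i ∸ 1) x z) ≡ c i
    b-prop   : ∀ (i : ℕ) (x y : Fin n) → i ≤ D → atDist adj i x y ≡ true →
               card (λ z → adj y z ∧ atDist adj (suc i) x z) ≡ b i
  a : ℕ → ℕ
  a i = k ∸ b i ∸ c i

ℕtoℚ : ℕ → ℚ
ℕtoℚ m = (+ m) ℚ./ 1

sumFin : ∀ {n} → (Fin n → ℚ) → ℚ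
sumFin {n} f = foldr (λ x acc → f x ℚ.+ acc) ℚ.0ℚ (allFin n)

adjMul : ∀ {n} → Graph n → (Fin n → ℚ) → Fin n → ℚ
adjMul adj v x = sumFin (λ y → if adj x y then v y else ℚ.0ℚ)

IsEigenvalue : ∀ {n} → Graph n → ℚ → Set
IsEigenvalue {n} adj θ =
  Σ (Fin n → ℚ) λ v → (Σ (Fin n) λ x → v x ≢ ℚ.0ℚ) × (∀ (x : Fin n) → adjMul adj v x ≡ θ ℚ.* v x)

-- θ is the second largest distinct eigenvalue of a k-regular graph (largest is k)
IsSecondLargestEigenvalue : ∀ {n} → Graph n → ℕ → ℚ → Set
IsSecondLargestEigenvalue adj k θ =
  IsEigenvalue adj θ × (θ ℚ.< ℕtoℚ k) ×
  (∀ (μ : ℚ) → IsEigenvalue adj μ → μ ≢ ℕtoℚ k → μ ℚ.≤ θ)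

edgeBoundary : ∀ {n} → Graph n → (Fin n → Bool) → ℕ
edgeBoundary {n} adj S = foldr _+_ 0 (map (λ x → if S x then card (λ y → adj x y ∧ not (S y)) else 0) (allFin n))

vol : ∀ {n} → Graph n → (Fin n → Bool) → ℕ
vol {n} adj S = foldr _+_ 0 (map (λ x → if S x then card (adj x) else 0) (allFin n))

-- h_G ≤ p / q  (q > 0): since h_G is a minimum over admissible S, this says some
-- nonempty S with |S| ≤ |V|/2 has E[S,S^c]/vol(S) ≤ p/q  (cross-multiplied)
CheegerAtMost : ∀ {n} → Graph n → ℕ → ℕ → Set
CheegerAtMost {n} adj p q =
  Σ (Fin n → Bool) λ S → (1 ≤ card S) × (2 * card S ≤ n) ×
    (edgeBoundary adj S * q ≤ p * vol adj S)

{-# OPTIONS --safe #-}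
-- Take S = Γ₃(x) for a vertex x of eccentricity 3. A neighbour of y ∈ S outside S lies in
-- Γ₂(x), so each vertex of S has at most c₃ edges leaving S, while vol(S) = k|S|. Hence
-- E[S,Sᶜ]/vol(S) ≤ c₃/k ≤ (k − a₃)/k, and |S| ≤ |V|/2 is the hypothesis.
module Submission where

open import Defs
open import Data.Nat using (ℕ; _*_; _∸_; _≤_)
open import Data.Fin using (Fin)

open import Data.Nat using (suc; _+_; z≤n; s≤s)
open import Data.Nat.ListAction using (sum)
open import Data.Nat.Properties
open import Data.Bool using (Bool; true; false; _∧_; _∨_; not; if_then_else_)
import Data.Bool as Bool
open import Data.Bool.Properties using (T-≡; ∨-zeroʳ; ∧-conicalˡ; ∧-conicalʳ; not-injective; not-¬; ¬-not)
open import Data.Bool.ListAction using (any)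
open import Data.List using (List; []; _∷_; allFin; filter; length; map)
open import Data.List.Membership.Propositional using (lose)
open import Data.List.Membership.Propositional.Properties using (∈-allFin; ∈-filter⁺; ∈-length)
open import Data.List.Relation.Binary.Sublist.Propositional using (⊆-refl)
open import Data.List.Relation.Binary.Sublist.Propositional.Properties using (filter⁺; length-mono-≤)
open import Data.List.Relation.Unary.Any.Properties using (any⁺)
open import Data.Product using (_,_; proj₁; proj₂)
open import Function using (Equivalence)
open import Relation.Binary.PropositionalEquality

module _ {A : Set} where

  count : (A → Bool) → List A → ℕ
  count P xs = length (filter (λ z → P z Bool.≟ true) xs)

  sumWhere : (A → Bool) → (A → ℕ) → List A → ℕ
  sumWhere S f xs = sum (map (λ x → if S x then f x else 0) xs)

  sumWhere-≤ : ∀ (S : A → Bool) {f : A → ℕ} {m} → (∀ x → S x ≡ true → f x ≤ m) →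
               ∀ xs → sumWhere S f xs ≤ count S xs * m
  sumWhere-≤ S f≤m [] = z≤n
  sumWhere-≤ S f≤m (x ∷ xs) with S x in Sx
  ... | true  = +-mono-≤ (f≤m x Sx) (sumWhere-≤ S f≤m xs)
  ... | false = sumWhere-≤ S f≤m xs

  sumWhere-≡ : ∀ (S : A → Bool) {f : A → ℕ} {m} → (∀ x → f x ≡ m) →
               ∀ xs → sumWhere S f xs ≡ count S xs * m
  sumWhere-≡ S f≡m [] = refl
  sumWhere-≡ S f≡m (x ∷ xs) with S x
  ... | true  = cong₂ _+_ (f≡m x) (sumWhere-≡ S f≡m xs)
  ... | false = sumWhere-≡ S f≡m xs

module _ {n : ℕ} where

  card-mono : ∀ {P Q : Fin n → Bool} → (∀ x → P x ≡ true → Q x ≡ true) → card P ≤ card Q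
  card-mono {P} {Q} P⇒Q =
    length-mono-≤ (filter⁺ (λ z → P z Bool.≟ true) (λ z → Q z Bool.≟ true)
                           (λ { refl → P⇒Q _ }) (⊆-refl {x = allFin n}))

  card-pos : ∀ {P : Fin n → Bool} x → P x ≡ true → 1 ≤ card P
  card-pos {P} x Px = ∈-length (∈-filter⁺ (λ z → P z Bool.≟ true) (∈-allFin x) Px)

module _ {n : ℕ} (adj : Graph n) where

  within-step : ∀ {i x y z} → within adj i x z ≡ true → adj z y ≡ true → within adj (suc i) x y ≡ true
  within-step {i} {x} {y} {z} x⇝z z~y = trans (cong (within adj i x y ∨_) viaZ) (∨-zeroʳ _)
    where
    viaZ : any (λ u → within adj i x u ∧ adj u y) (allFin n) ≡ true
    viaZ = Equivalence.to T-≡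
             (any⁺ _ (lose (∈-allFin z) (Equivalence.from T-≡ (cong₂ _∧_ x⇝z z~y))))

  outerLayer-neighbour : ∀ {i x y z} → (∀ u → within adj (suc (suc i)) x u ≡ true) →
                         atDist adj (suc (suc i)) x y ≡ true → adj z y ≡ true →
                         atDist adj (suc (suc i)) x z ≡ false → atDist adj (suc i) x z ≡ true
  outerLayer-neighbour {i} {x} {y} {z} eccentric y∈Γ z~y z∉Γ = cong₂ (λ p q → p ∧ not q) z∈B₁ z∉B₀
    where
    y∉B₁ : within adj (suc i) x y ≡ false
    y∉B₁ = not-injective (∧-conicalʳ _ _ y∈Γ)
    z∈B₁ : within adj (suc i) x z ≡ true
    z∈B₁ = not-injective (trans (cong (_∧ not (within adj (suc i) x z)) (sym (eccentric z))) z∉Γ)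
    z∉B₀ : within adj i x z ≡ false
    z∉B₀ = ¬-not (λ z∈B₀ → not-¬ (within-step {i} z∈B₀ z~y) y∉B₁)

  outerLayer-boundaryDegree : ∀ {i x y} → (∀ u v → adj u v ≡ adj v u) →
    (∀ u → within adj (suc (suc i)) x u ≡ true) → atDist adj (suc (suc i)) x y ≡ true →
    card (λ z → adj y z ∧ not (atDist adj (suc (suc i)) x z)) ≤
    card (λ z → adj y z ∧ atDist adj (suc i) x z)
  outerLayer-boundaryDegree {i} {x} {y} symmetric eccentric y∈Γ = card-mono λ z h →
    let y~z = ∧-conicalˡ _ _ h
        z∉Γ = not-injective (∧-conicalʳ _ _ h)
    in cong₂ _∧_ y~z (outerLayer-neighbour {i} {x} {y} {z} eccentric y∈Γ (trans (symmetric _ _) y~z) z∉Γ)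

  cheegerAtMost-fromUniformBounds : ∀ {p q} (S : Fin n → Bool) → 1 ≤ card S → 2 * card S ≤ n →
    edgeBoundary adj S ≤ card S * p → vol adj S ≡ card S * q → CheegerAtMost adj p q
  cheegerAtMost-fromUniformBounds {p} {q} S nonempty small boundary volume =
    S , nonempty , small , (begin
      edgeBoundary adj S * q ≤⟨ *-monoˡ-≤ q boundary ⟩
      card S * p * q         ≡⟨ cong (_* q) (*-comm (card S) p) ⟩
      p * card S * q         ≡⟨ *-assoc p (card S) q ⟩
      p * (card S * q)       ≡⟨ cong (p *_) volume ⟨
      p * vol adj S          ∎)
    where open ≤-Reasoning

module _ {n d : ℕ} {adj : Graph n} (G : IsDRG adj (suc (suc d))) where
  open IsDRG G

  vol-regular : ∀ S → vol adj S ≡ card S * k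
  vol-regular S = sumWhere-≡ S regular (allFin n)

  c≤k : ∀ i {x y} → 1 ≤ i → i ≤ suc (suc d) → atDist adj i x y ≡ true → c i ≤ k
  c≤k i {x} {y} 1≤i i≤D y∈Γ = begin
    c i                                         ≡⟨ c-prop i x y 1≤i i≤D y∈Γ ⟨
    card (λ z → adj y z ∧ atDist adj (i ∸ 1) x z) ≤⟨ card-mono {Q = adj y} (λ z → ∧-conicalˡ _ _) ⟩
    card (adj y)                                ≡⟨ regular y ⟩
    k                                           ∎
    where open ≤-Reasoning

  c≤k∸a : ∀ i → c i ≤ k → c i ≤ k ∸ a i
  c≤k∸a i cᵢ≤k = begin
    c i                   ≡⟨ m∸[m∸n]≡n cᵢ≤k ⟨
    k ∸ (k ∸ c i)         ≤⟨ ∸-monoʳ-≤ k (∸-monoˡ-≤ (c i) (m∸n≤m k (b i))) ⟩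
    k ∸ (k ∸ b i ∸ c i)   ∎
    where open ≤-Reasoning

  edgeBoundary-outerLayer : ∀ x → let S = atDist adj (suc (suc d)) x in
                            edgeBoundary adj S ≤ card S * c (suc (suc d))
  edgeBoundary-outerLayer x = sumWhere-≤ (atDist adj (suc (suc d)) x) (λ y y∈Γ → begin
    card (λ z → adj y z ∧ not (atDist adj (suc (suc d)) x z))
      ≤⟨ outerLayer-boundaryDegree adj {d} {x} {y} (proj₁ simple) (proj₁ diameter x) y∈Γ ⟩
    card (λ z → adj y z ∧ atDist adj (suc d) x z)
      ≡⟨ c-prop (suc (suc d)) x y (s≤s z≤n) ≤-refl y∈Γ ⟩
    c (suc (suc d)) ∎) (allFin n)
    where open ≤-Reasoning

proposition5p7 : ∀ (n : ℕ) (adj : Graph n) (G : IsDRG adj 3) →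
    IsSecondLargestEigenvalue adj (IsDRG.k G) (ℕtoℚ (IsDRG.a G 3)) →
    (∀ (x : Fin n) → 2 * card (atDist adj 3 x) ≤ n) →
    CheegerAtMost adj (IsDRG.k G ∸ IsDRG.a G 3) (IsDRG.k G)
proposition5p7 n adj G _ halfSize =
  cheegerAtMost-fromUniformBounds adj (atDist adj 3 x) (card-pos y y∈Γ₃) (halfSize x)
                                  boundary (vol-regular G _)
  where
  open IsDRG G
  x y : Fin n
  x = proj₁ (proj₂ diameter)
  y = proj₁ (proj₂ (proj₂ diameter))
  y∈Γ₃ : atDist adj 3 x y ≡ true
  y∈Γ₃ = proj₂ (proj₂ (proj₂ diameter))
  boundary : edgeBoundary adj (atDist adj 3 x) ≤ card (atDist adj 3 x) * (k ∸ a 3)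
  boundary = ≤-trans (edgeBoundary-outerLayer G x)
                     (*-monoʳ-≤ (card (atDist adj 3 x)) (c≤k∸a G 3 (c≤k G 3 {x} {y} (s≤s z≤n) ≤-refl y∈Γ₃)))
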